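{- Let $k$ be an even positive integer and $G=\{1,\zeta,\dots,\zeta^{k-1}\}\subset\mathbb C^*$ the group of $k$-th roots of unity, $\zeta=e^{2\pi i/k}$. Then $G$ is $2$-maximal in $\mathbb C$.
   Context: For a commutative ring $R$ with $2\in R^*$, a subgroup $G\subset R^*$ is even if $-1\in G$; an even subgroup $G$ is $2$-maximal if whenever $a-b=2(c-d)$ with $a,b,c,d\in G$, then $a=\pm b$. -}

module Defs where

open import Level using (Level; _⊔_)
open import Data.Nat using (ℕ; zero; suc; _<_; _≡ᵇ_)
open import Data.Nat.Divisibility using (_∣_)
open import Data.Product using (Σ; ∃; _×_; _,_)
open import Data.Sum using (_⊎_)
open import Relation.Binary.PropositionalEquality using (_≡_)
open import Relation.Nullary using (¬_)
open import Algebra.Bundles using (CommutativeRing)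
import Algebra.Bundles
import Algebra.Definitions.RawSemiring as RS

module _ {c ℓ : Level} (R : CommutativeRing c ℓ) where
  open CommutativeRing R
  open RS (Algebra.Bundles.Semiring.rawSemiring semiring) using (_^_) renaming (_×_ to _·_)

  two : Carrier
  two = 1# + 1#

  IsField : Set (c ⊔ ℓ)
  IsField = (¬ (1# ≈ 0#)) × (∀ x → ¬ (x ≈ 0#) → ∃ λ y → x * y ≈ 1#)

  CharZero : Set ℓ
  CharZero = ∀ n → (n · 1#) ≈ 0# → n ≡ 0

  IsPrimitiveRoot : Carrier → ℕ → Set ℓ
  IsPrimitiveRoot ζ k = (ζ ^ k ≈ 1#) × (∀ i → 0 < i → i < k → ¬ (ζ ^ i ≈ 1#))

  Powers : Carrier → ℕ → Carrier → Set ℓ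
  Powers ζ k x = Σ ℕ λ i → (i < k) × (x ≈ ζ ^ i)

  IsEven : (Carrier → Set ℓ) → Set ℓ
  IsEven G = G (- 1#)

  Is2Maximal : (Carrier → Set ℓ) → Set (c ⊔ ℓ)
  Is2Maximal G = IsEven G ×
    (∀ a b c′ d → G a → G b → G c′ → G d →
       a - b ≈ two * (c′ - d) → (a ≈ b) ⊎ (a ≈ - b))

-- Let G be the group of K-th roots of unity generated by ζ and ℤ[ζ] the ℤ-span of
-- 1, ζ, …, ζ^(K-1), a subring. If a - b = 2(c - d) in G, then x = a b⁻¹ is a root of unity with
-- x ≡ 1 (mod 2ℤ[ζ]), and such an x is ±1 unless 1 ∈ 2ℤ[ζ]. Indeed, if x has odd order n and
-- x ≠ 1 then 0 = 1 + x + ⋯ + x^(n-1) ≡ n ≡ 1; if the order is even, x² is again ≡ 1 and is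
-- neither 1 nor -1 (from x² = -1 and 1 - x = 2w one gets 1 = 2w²x), so induct on the order.
-- Finally 1 = 2u with u ∈ ℤ[ζ] is impossible: writing u ζ^i = Σⱼ Wᵢⱼ ζ^j, the vector (ζ^j)
-- is annihilated by I - 2W, whose determinant is odd, hence non-zero in characteristic 0.
-- Fraction-free Gaussian elimination, which keeps the diagonal odd and the rest even, makes
-- this argument constructive. As equality in R is undecidable, the dichotomy a = ±b is read
-- off the exponents of a and b.
module Submission where

open import Defs
open import Level using (Level; _⊔_)
open import Data.Nat using (ℕ; _<_)
open import Data.Nat.Divisibility using (_∣_)
open import Algebra.Bundles using (CommutativeRing)

import Algebra.Solver.Ring
open import Algebra.Solver.Ring.AlmostCommutativeRing
  using (fromCommutativeRing; _-Raw-AlmostCommutative⟶_)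
open import Data.Empty using (⊥; ⊥-elim)
open import Data.Fin using (Fin; zero; suc; toℕ; fromℕ<)
open import Data.Fin.Properties using (toℕ-fromℕ<)
open import Data.Integer as ℤ using (ℤ; +_; -[1+_]; _⊖_; _◃_; sign; ∣_∣)
import Data.Integer.Properties as ℤ
import Data.Integer.Divisibility.Signed as ℤ∣
import Data.Integer.Tactic.RingSolver as ℤ-Solver
import Data.Maybe as Maybe
open import Data.Nat as ℕ using (zero; suc; _∸_; z≤n; s≤s)
open import Data.Nat.Divisibility using (divides; ∣1⇒≡1)
open import Data.Nat.Induction using (<-rec)
import Data.Nat.Properties as ℕ
open import Data.Product using (∃; _×_; _,_; proj₁; proj₂)
open import Data.Sign as Sign using (Sign)
open import Data.Sum using (_⊎_; inj₁; inj₂)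
open import Function using (_∘_)
open import Relation.Binary.Definitions using (tri<; tri≈; tri>)
open import Relation.Binary.PropositionalEquality as ≡ using (_≡_; _≢_)
open import Relation.Nullary using (¬_; Dec; yes; no)
import Relation.Nullary.Decidable as Dec
open import Relation.Nullary.Decidable using (dec⇒maybe)

record Odd (p : ℤ) : Set where
  constructor odd
  field
    2∣p-1 : + 2 ℤ∣.∣ p ℤ.- ℤ.1ℤ

odd-1 : Odd ℤ.1ℤ
odd-1 = odd (ℤ∣.divides ℤ.0ℤ ≡.refl)

odd-* : ∀ {p q} → Odd p → Odd q → Odd (p ℤ.* q)
odd-* {p} {q} (odd 2∣p-1) (odd 2∣q-1) = odd (≡.subst (+ 2 ℤ∣.∣_) (identity p q)
  (ℤ∣.∣m∣n⇒∣m+n (ℤ∣.∣m⇒∣m*n q 2∣p-1) 2∣q-1))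
  where
  identity : ∀ p q → (p ℤ.- ℤ.1ℤ) ℤ.* q ℤ.+ (q ℤ.- ℤ.1ℤ) ≡ p ℤ.* q ℤ.- ℤ.1ℤ
  identity = ℤ-Solver.solve-∀

odd-minus-twice : ∀ {p} w → Odd p → Odd (p ℤ.- + 2 ℤ.* w)
odd-minus-twice {p} w (odd 2∣p-1) = odd (≡.subst (+ 2 ℤ∣.∣_) (identity p w)
  (ℤ∣.∣m∣n⇒∣m-n 2∣p-1 (ℤ∣.∣m⇒∣m*n w ℤ∣.∣-refl)))
  where
  identity : ∀ p w → (p ℤ.- ℤ.1ℤ) ℤ.- + 2 ℤ.* w ≡ (p ℤ.- + 2 ℤ.* w) ℤ.- ℤ.1ℤ
  identity = ℤ-Solver.solve-∀

odd⇒≢0 : ∀ {p} → Odd p → p ≢ ℤ.0ℤ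
odd⇒≢0 (odd 2∣-1) ≡.refl with () ← ∣1⇒≡1 (ℤ∣.∣⇒∣ᵤ 2∣-1)

data ParityView : ℕ → Set where
  even : ∀ q → ParityView (q ℕ.+ q)
  odd  : ∀ q → ParityView (suc (q ℕ.+ q))

parityView : ∀ n → ParityView n
parityView zero = even 0
parityView (suc n) with parityView n
... | even q = odd q
... | odd q  = ≡.subst ParityView (≡.cong suc (ℕ.+-suc q q)) (even (suc q))

module IntegerImage {c ℓ : Level} (R : CommutativeRing c ℓ) where
  open CommutativeRing R
  open import Algebra.Properties.Ring ring
    using (-‿involutive; -0#≈0#; -‿distribˡ-*; -‿distribʳ-*; -‿+-comm)
  open import Algebra.Properties.Semiring.Mult.TCOptimised semiring
    using (1+×; ×-homo-+; ×1-homo-*) renaming (_×_ to _·_)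
  open import Relation.Binary.Reasoning.Setoid setoid

  -- Built on the optimised _×′_, so that ι (+ 1) and ι (+ 2) are 1# and two R on the nose, as
  -- the ring solver below requires of its constants.
  ι : ℤ → Carrier
  ι (+ n)    = n · 1#
  ι -[1+ n ] = - (suc n · 1#)

  signed : Sign → Carrier → Carrier
  signed Sign.+ x = x
  signed Sign.- x = - x

  signed-cong : ∀ s {x y} → x ≈ y → signed s x ≈ signed s y
  signed-cong Sign.+ x≈y = x≈y
  signed-cong Sign.- x≈y = -‿cong x≈y

  signed-* : ∀ s t x y → signed (s Sign.* t) (x * y) ≈ signed s x * signed t y
  signed-* Sign.+ Sign.+ x y = refl
  signed-* Sign.+ Sign.- x y = -‿distribʳ-* x y
  signed-* Sign.- Sign.+ x y = -‿distribˡ-* x y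
  signed-* Sign.- Sign.- x y = begin
    x * y         ≈⟨ -‿involutive (x * y) ⟨
    - - (x * y)   ≈⟨ -‿cong (-‿distribʳ-* x y) ⟩
    - (x * - y)   ≈⟨ -‿distribˡ-* x (- y) ⟩
    - x * - y     ∎

  ι-◃ : ∀ s n → ι (s ◃ n) ≈ signed s (n · 1#)
  ι-◃ Sign.+ zero    = refl
  ι-◃ Sign.+ (suc n) = refl
  ι-◃ Sign.- zero    = sym -0#≈0#
  ι-◃ Sign.- (suc n) = refl

  ι≈signed∣_∣ : ∀ i → ι i ≈ signed (sign i) (∣ i ∣ · 1#)
  ι≈signed∣ + n    ∣ = refl
  ι≈signed∣ -[1+ n ] ∣ = refl

  ι-* : ∀ i j → ι (i ℤ.* j) ≈ ι i * ι j
  ι-* i j = begin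
    ι (i ℤ.* j)                                         ≈⟨ ι-◃ (sign i Sign.* sign j) (∣ i ∣ ℕ.* ∣ j ∣) ⟩
    signed (sign i Sign.* sign j) ((∣ i ∣ ℕ.* ∣ j ∣) · 1#) ≈⟨ signed-cong (sign i Sign.* sign j) (×1-homo-* ∣ i ∣ ∣ j ∣) ⟩
    signed (sign i Sign.* sign j) (∣ i ∣ · 1# * ∣ j ∣ · 1#) ≈⟨ signed-* (sign i) (sign j) _ _ ⟩
    signed (sign i) (∣ i ∣ · 1#) * signed (sign j) (∣ j ∣ · 1#) ≈⟨ *-cong ι≈signed∣ i ∣ ι≈signed∣ j ∣ ⟨
    ι i * ι j                                           ∎

  ι-⊖ : ∀ m n → ι (m ⊖ n) ≈ m · 1# - n · 1#
  ι-⊖ zero    zero    = sym (-‿inverseʳ 0#)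
  ι-⊖ zero    (suc n) = sym (+-identityˡ _)
  ι-⊖ (suc m) zero    = sym (trans (+-congˡ -0#≈0#) (+-identityʳ _))
  ι-⊖ (suc m) (suc n) = begin
    ι (suc m ⊖ suc n)              ≡⟨ ≡.cong ι (ℤ.[1+m]⊖[1+n]≡m⊖n m n) ⟩
    ι (m ⊖ n)                      ≈⟨ ι-⊖ m n ⟩
    m · 1# - n · 1#                ≈⟨ +-cancel-shared 1# (m · 1#) (n · 1#) ⟨
    (1# + m · 1#) - (1# + n · 1#)  ≈⟨ +-cong (1+× m 1#) (-‿cong (1+× n 1#)) ⟨
    suc m · 1# - suc n · 1#        ∎
    where
    +-cancel-shared : ∀ z x y → (z + x) - (z + y) ≈ x - y
    +-cancel-shared z x y = begin
      (z + x) - (z + y)      ≈⟨ +-congˡ (-‿+-comm z y) ⟨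
      (z + x) + (- z - y)    ≈⟨ +-congʳ (+-comm z x) ⟩
      (x + z) + (- z - y)    ≈⟨ +-assoc x z (- z - y) ⟩
      x + (z + (- z - y))    ≈⟨ +-congˡ (+-assoc z (- z) (- y)) ⟨
      x + ((z - z) - y)      ≈⟨ +-congˡ (+-congʳ (-‿inverseʳ z)) ⟩
      x + (0# - y)           ≈⟨ +-congˡ (+-identityˡ (- y)) ⟩
      x - y                  ∎

  ι-+ : ∀ i j → ι (i ℤ.+ j) ≈ ι i + ι j
  ι-+ (+ m)    (+ n)    = ×-homo-+ 1# m n
  ι-+ (+ m)    -[1+ n ] = ι-⊖ m (suc n)
  ι-+ -[1+ m ] (+ n)    = trans (ι-⊖ n (suc m)) (+-comm _ _)
  ι-+ -[1+ m ] -[1+ n ] = begin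
    - (suc (suc (m ℕ.+ n)) · 1#)        ≡⟨ ≡.cong (λ k → - (k · 1#)) (ℕ.+-suc (suc m) n) ⟨
    - ((suc m ℕ.+ suc n) · 1#)          ≈⟨ -‿cong (×-homo-+ 1# (suc m) (suc n)) ⟩
    - (suc m · 1# + suc n · 1#)         ≈⟨ -‿+-comm _ _ ⟨
    - (suc m · 1#) + - (suc n · 1#)     ∎

  ι-neg : ∀ i → ι (ℤ.- i) ≈ - ι i
  ι-neg (+ zero)  = sym -0#≈0#
  ι-neg (+ suc n) = refl
  ι-neg -[1+ n ]  = sym (-‿involutive _)

  ι-suc : ∀ n → ι (+ suc n) ≈ 1# + ι (+ n)
  ι-suc n = 1+× n 1#

  ι-sub : ∀ i j → ι (i ℤ.- j) ≈ ι i - ι j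
  ι-sub i j = trans (ι-+ i (ℤ.- j)) (+-congˡ (ι-neg j))

  ι-homomorphism : ℤ.+-*-rawRing -Raw-AlmostCommutative⟶ fromCommutativeRing R
  ι-homomorphism = record
    { ⟦_⟧    = ι
    ; +-homo = ι-+
    ; *-homo = ι-*
    ; -‿homo = ι-neg
    ; 0-homo = refl
    ; 1-homo = refl
    }

  open Algebra.Solver.Ring ℤ.+-*-rawRing (fromCommutativeRing R) ι-homomorphism
    (λ i j → Maybe.map (reflexive ∘ ≡.cong ι) (dec⇒maybe (i ℤ.≟ j)))
    public using (solve; _:=_; con; _:+_; _:*_; _:-_; :-_)

module Subrings {c ℓ : Level} (R : CommutativeRing c ℓ) where
  open CommutativeRing R
  open IntegerImage R

  record IsSubring {s} (S : Carrier → Set s) : Set (c ⊔ ℓ ⊔ s) where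
    field
      ∈-resp-≈ : ∀ {x y} → x ≈ y → S x → S y
      1∈       : S 1#
      +-closed : ∀ {x y} → S x → S y → S (x + y)
      -‿closed : ∀ {x} → S x → S (- x)
      *-closed : ∀ {x y} → S x → S y → S (x * y)

    ι∈ : ∀ i → S (ι i)
    ι∈ (+ n)    = ι+∈ n
      where
      ι+∈ : ∀ n → S (ι (+ n))
      ι+∈ zero          = ∈-resp-≈ (-‿inverseʳ 1#) (+-closed 1∈ (-‿closed 1∈))
      ι+∈ (suc zero)    = 1∈
      ι+∈ (suc (suc n)) = +-closed (ι+∈ (suc n)) 1∈
    ι∈ -[1+ n ] = -‿closed (ι∈ (+ suc n))

module LinearCombinations {c ℓ : Level} (R : CommutativeRing c ℓ) where
  open CommutativeRing R hiding (zero)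
  open IntegerImage R
  open Subrings R
  open import Algebra.Properties.Ring ring using (-1*x≈-x)
  open import Algebra.Properties.Semiring.Sum semiring
    using (sum; sum-cong-≋; sum-replicate-zero; ∑-distrib-+; *-distribˡ-sum; *-distribʳ-sum)
  open import Relation.Binary.Reasoning.Setoid setoid

  private variable
    m n : ℕ
    x y : Carrier
    g : Fin n → Carrier

  lincomb : (Fin n → ℤ) → (Fin n → Carrier) → Carrier
  lincomb a g = sum λ j → ι (a j) * g j

  lincomb-zeroˡ : (g : Fin n → Carrier) → lincomb (λ _ → ℤ.0ℤ) g ≈ 0#
  lincomb-zeroˡ {n} g = trans (sum-cong-≋ (λ j → zeroˡ (g j))) (sum-replicate-zero n)

  lincomb-zeroʳ : (a : Fin n → ℤ) → (∀ j → g j ≈ 0#) → lincomb a g ≈ 0#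
  lincomb-zeroʳ {n} a g≈0 =
    trans (sum-cong-≋ (λ j → trans (*-congˡ (g≈0 j)) (zeroʳ _))) (sum-replicate-zero n)

  lincomb-+ : ∀ (a b : Fin n → ℤ) g → lincomb (λ j → a j ℤ.+ b j) g ≈ lincomb a g + lincomb b g
  lincomb-+ a b g = trans
    (sum-cong-≋ (λ j → trans (*-congʳ (ι-+ (a j) (b j))) (distribʳ (g j) _ _)))
    (∑-distrib-+ (λ j → ι (a j) * g j) (λ j → ι (b j) * g j))

  lincomb-scale : ∀ k (a : Fin n → ℤ) g → lincomb (λ j → k ℤ.* a j) g ≈ ι k * lincomb a g
  lincomb-scale k a g = trans
    (sum-cong-≋ (λ j → trans (*-congʳ (ι-* k (a j))) (*-assoc _ _ _)))
    (sym (*-distribˡ-sum (ι k) (λ j → ι (a j) * g j)))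

  lincomb-*ʳ : ∀ (a : Fin n → ℤ) g y → lincomb a g * y ≈ lincomb a (λ j → g j * y)
  lincomb-*ʳ a g y = trans (*-distribʳ-sum y (λ j → ι (a j) * g j))
    (sum-cong-≋ (λ j → *-assoc (ι (a j)) (g j) y))

  Span : (Fin n → Carrier) → Carrier → Set ℓ
  Span g x = ∃ λ a → x ≈ lincomb a g

  Span-resp-≈ : x ≈ y → Span g x → Span g y
  Span-resp-≈ x≈y (a , x≈) = a , trans (sym x≈y) x≈

  Span-0 : Span g 0#
  Span-0 {g = g} = (λ _ → ℤ.0ℤ) , sym (lincomb-zeroˡ g)

  Span-+ : Span g x → Span g y → Span g (x + y)
  Span-+ {g = g} (a , x≈) (b , y≈) = (λ j → a j ℤ.+ b j) , trans (+-cong x≈ y≈) (sym (lincomb-+ a b g))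

  Span-scale : ∀ k → Span g x → Span g (ι k * x)
  Span-scale {g = g} k (a , x≈) = (λ j → k ℤ.* a j) , trans (*-congˡ x≈) (sym (lincomb-scale k a g))

  Span-generator : (g : Fin n → Carrier) → ∀ i → Span g (g i)
  Span-generator g zero = (λ { zero → ℤ.1ℤ ; (suc _) → ℤ.0ℤ }) , sym (begin
    1# * g zero + lincomb (λ _ → ℤ.0ℤ) (g ∘ suc) ≈⟨ +-cong (*-identityˡ _) (lincomb-zeroˡ (g ∘ suc)) ⟩
    g zero + 0#                                   ≈⟨ +-identityʳ _ ⟩
    g zero                                        ∎)
  Span-generator g (suc i) with Span-generator (g ∘ suc) i
  ... | a , gi≈ = (λ { zero → ℤ.0ℤ ; (suc j) → a j }) , (begin
    g (suc i)                          ≈⟨ gi≈ ⟩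
    lincomb a (g ∘ suc)                ≈⟨ +-identityˡ _ ⟨
    0# + lincomb a (g ∘ suc)           ≈⟨ +-congʳ (zeroˡ (g zero)) ⟨
    0# * g zero + lincomb a (g ∘ suc)  ∎)

  Span-lincomb : ∀ (a : Fin m → ℤ) s → (∀ j → Span g (s j)) → Span g (lincomb a s)
  Span-lincomb {zero}  a s s∈ = Span-0
  Span-lincomb {suc m} a s s∈ =
    Span-+ (Span-scale (a zero) (s∈ zero)) (Span-lincomb (a ∘ suc) (s ∘ suc) (s∈ ∘ suc))

  Span-* : (∀ i j → Span g (g i * g j)) → Span g x → Span g y → Span g (x * y)
  Span-* {g = g} {x = x} {y = y} gg∈ (a , x≈) (b , y≈) =
    Span-resp-≈ (sym x*y≈) (Span-lincomb a _ λ i →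
      Span-resp-≈ (sym (gi*y≈ i)) (Span-lincomb b _ (λ j → gg∈ j i)))
    where
    x*y≈ : x * y ≈ lincomb a (λ i → g i * y)
    x*y≈ = trans (*-congʳ x≈) (lincomb-*ʳ a g y)
    gi*y≈ : ∀ i → g i * y ≈ lincomb b (λ j → g j * g i)
    gi*y≈ i = trans (*-comm _ _) (trans (*-congʳ y≈) (lincomb-*ʳ b g (g i)))

  Span-isSubring : (∀ i j → Span g (g i * g j)) → Span g 1# → IsSubring (Span g)
  Span-isSubring gg∈ 1∈ = record
    { ∈-resp-≈ = Span-resp-≈
    ; 1∈       = 1∈
    ; +-closed = Span-+
    ; -‿closed = λ x∈ → Span-resp-≈ (-1*x≈-x _) (Span-scale ℤ.-1ℤ x∈)
    ; *-closed = Span-* gg∈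
    }

module CharZeroField {c ℓ : Level} (R : CommutativeRing c ℓ)
                     (isField : IsField R) (charZero : CharZero R) where
  open CommutativeRing R hiding (zero)
  open IntegerImage R
  open Subrings R
  open LinearCombinations R
  open import Algebra.Properties.Ring ring using (-0#≈0#; -‿injective; +-inverseˡ-unique; x∙y⁻¹≈ε⇒x≈y)
  open import Algebra.Properties.Semiring.Mult.TCOptimised semiring using (×ᵤ≈×)
  open import Relation.Binary.Reasoning.Setoid setoid

  private variable
    n : ℕ
    x y z : Carrier

  x*y≈0⇒y≈0 : ¬ x ≈ 0# → x * y ≈ 0# → y ≈ 0#
  x*y≈0⇒y≈0 {x} {y} x≉0 x*y≈0 with proj₂ isField x x≉0
  ... | x⁻¹ , x*x⁻¹≈1 = begin
    y               ≈⟨ *-identityˡ y ⟨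
    1# * y          ≈⟨ *-congʳ x*x⁻¹≈1 ⟨
    (x * x⁻¹) * y   ≈⟨ solve 3 (λ x x⁻¹ y → (x :* x⁻¹) :* y := x⁻¹ :* (x :* y)) refl x x⁻¹ y ⟩
    x⁻¹ * (x * y)   ≈⟨ *-congˡ x*y≈0 ⟩
    x⁻¹ * 0#        ≈⟨ zeroʳ x⁻¹ ⟩
    0#              ∎

  *-cancelˡ : ¬ x ≈ 0# → x * y ≈ x * z → y ≈ z
  *-cancelˡ {x} {y} {z} x≉0 x*y≈x*z = x∙y⁻¹≈ε⇒x≈y y z (x*y≈0⇒y≈0 x≉0 (begin
    x * (y - z)    ≈⟨ solve 3 (λ x y z → x :* (y :- z) := x :* y :- x :* z) refl x y z ⟩
    x * y - x * z  ≈⟨ +-congʳ x*y≈x*z ⟩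
    x * z - x * z  ≈⟨ -‿inverseʳ (x * z) ⟩
    0#             ∎))

  x*y≈1⇒x≉0 : x * y ≈ 1# → ¬ x ≈ 0#
  x*y≈1⇒x≉0 {x} {y} x*y≈1 x≈0 = proj₁ isField (begin
    1#      ≈⟨ x*y≈1 ⟨
    x * y   ≈⟨ *-congʳ x≈0 ⟩
    0# * y  ≈⟨ zeroˡ y ⟩
    0#      ∎)

  x*x≈1⇒x≈-1 : ¬ x ≈ 1# → x * x ≈ 1# → x ≈ - 1#
  x*x≈1⇒x≈-1 {x} x≉1 x*x≈1 = +-inverseˡ-unique x 1# (x*y≈0⇒y≈0 x-1≉0 (begin
    (x - 1#) * (x + 1#)  ≈⟨ solve 1 (λ x → (x :- con (+ 1)) :* (x :+ con (+ 1)) := x :* x :- con (+ 1)) refl x ⟩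
    x * x - 1#           ≈⟨ +-congʳ x*x≈1 ⟩
    1# - 1#              ≈⟨ -‿inverseʳ 1# ⟩
    0#                   ∎))
    where
    x-1≉0 : ¬ x - 1# ≈ 0#
    x-1≉0 = x≉1 ∘ x∙y⁻¹≈ε⇒x≈y x 1#

  ι≈0⇒≡0 : ∀ i → ι i ≈ 0# → i ≡ ℤ.0ℤ
  ι≈0⇒≡0 (+ n)    ι≈0 = ≡.cong +_ (charZero n (trans (×ᵤ≈× n 1#) ι≈0))
  ι≈0⇒≡0 -[1+ n ] ι≈0
    with () ← charZero (suc n) (trans (×ᵤ≈× (suc n) 1#) (-‿injective (trans ι≈0 (sym -0#≈0#))))

  odd⇒ι≉0 : ∀ {p} → Odd p → ¬ ι p ≈ 0#
  odd⇒ι≉0 odd-p = odd⇒≢0 odd-p ∘ ι≈0⇒≡0 _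

  two≉0 : ¬ two R ≈ 0#
  two≉0 two≈0 with () ← ι≈0⇒≡0 (+ 2) two≈0

  record OddSystem (g : Fin n → Carrier) : Set ℓ where
    field
      d     : Fin n → ℤ
      W     : Fin n → Fin n → ℤ
      d-odd : ∀ i → Odd (d i)
      row   : ∀ i → ι (d i) * g i ≈ two R * lincomb (W i) g

  module _ {g : Fin (suc n) → Carrier} (system : OddSystem g) where
    open OddSystem system

    pivot : ℤ
    pivot = d zero ℤ.- + 2 ℤ.* W zero zero

    pivot-odd : Odd pivot
    pivot-odd = odd-minus-twice (W zero zero) (d-odd zero)

    rest : Fin (suc n) → Carrier
    rest i = lincomb (W i ∘ suc) (g ∘ suc)

    pivot-row : ι pivot * g zero ≈ two R * rest zero
    pivot-row = begin
      ι pivot * g zero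
        ≈⟨ *-congʳ (trans (ι-sub (d zero) _) (+-congˡ (-‿cong (ι-* (+ 2) (W zero zero))))) ⟩
      (ι (d zero) - two R * ι (W zero zero)) * g zero
        ≈⟨ solve 3 (λ D w g₀ → (D :- con (+ 2) :* w) :* g₀ := D :* g₀ :- con (+ 2) :* (w :* g₀))
                 refl (ι (d zero)) (ι (W zero zero)) (g zero) ⟩
      ι (d zero) * g zero - two R * (ι (W zero zero) * g zero)
        ≈⟨ +-congʳ (row zero) ⟩
      two R * (ι (W zero zero) * g zero + rest zero) - two R * (ι (W zero zero) * g zero)
        ≈⟨ solve 2 (λ a r → con (+ 2) :* (a :+ r) :- con (+ 2) :* a := con (+ 2) :* r)
                 refl (ι (W zero zero) * g zero) (rest zero) ⟩
      two R * rest zero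
        ∎

    -- Fraction-free elimination of g zero: every other row is multiplied by the odd pivot and
    -- the first row, scaled by the even entry below the pivot, is subtracted.
    eliminate : OddSystem (g ∘ suc)
    eliminate = record
      { d     = λ i → pivot ℤ.* d (suc i)
      ; W     = W′
      ; d-odd = λ i → odd-* pivot-odd (d-odd (suc i))
      ; row   = row′
      }
      where
      W′ : Fin n → Fin n → ℤ
      W′ i j = + 2 ℤ.* W (suc i) zero ℤ.* W zero (suc j) ℤ.+ pivot ℤ.* W (suc i) (suc j)

      W′-row : ∀ i → lincomb (W′ i) (g ∘ suc) ≈
                     ι (+ 2 ℤ.* W (suc i) zero) * rest zero + ι pivot * rest (suc i)
      W′-row i = trans
        (lincomb-+ (λ j → + 2 ℤ.* W (suc i) zero ℤ.* W zero (suc j))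
                   (λ j → pivot ℤ.* W (suc i) (suc j)) (g ∘ suc))
        (+-cong (lincomb-scale (+ 2 ℤ.* W (suc i) zero) (W zero ∘ suc) (g ∘ suc))
                (lincomb-scale pivot (W (suc i) ∘ suc) (g ∘ suc)))

      row′ : ∀ i → ι (pivot ℤ.* d (suc i)) * g (suc i) ≈ two R * lincomb (W′ i) (g ∘ suc)
      row′ i = begin
        ι (pivot ℤ.* d (suc i)) * g (suc i)          ≈⟨ *-congʳ (ι-* pivot (d (suc i))) ⟩
        ι pivot * ι (d (suc i)) * g (suc i)          ≈⟨ *-assoc _ _ _ ⟩
        ι pivot * (ι (d (suc i)) * g (suc i))        ≈⟨ *-congˡ (row (suc i)) ⟩
        ι pivot * (two R * (ι cᵢ * g zero + rest (suc i)))
          ≈⟨ solve 4 (λ P C g₀ r → P :* (con (+ 2) :* (C :* g₀ :+ r))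
                                := con (+ 2) :* (C :* (P :* g₀) :+ P :* r))
                   refl (ι pivot) (ι cᵢ) (g zero) (rest (suc i)) ⟩
        two R * (ι cᵢ * (ι pivot * g zero) + ι pivot * rest (suc i))
          ≈⟨ *-congˡ (+-congʳ (*-congˡ pivot-row)) ⟩
        two R * (ι cᵢ * (two R * rest zero) + ι pivot * rest (suc i))
          ≈⟨ *-congˡ (+-congʳ (trans (solve 2 (λ C r → C :* (con (+ 2) :* r) := con (+ 2) :* C :* r)
                                              refl (ι cᵢ) (rest zero))
                                     (*-congʳ (sym (ι-* (+ 2) cᵢ))))) ⟩
        two R * (ι (+ 2 ℤ.* cᵢ) * rest zero + ι pivot * rest (suc i)) ≈⟨ *-congˡ (W′-row i) ⟨
        two R * lincomb (W′ i) (g ∘ suc)             ∎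
        where
        cᵢ : ℤ
        cᵢ = W (suc i) zero

  odd-system⇒≈0 : {g : Fin n → Carrier} → OddSystem g → ∀ i → g i ≈ 0#
  odd-system⇒≈0 system (suc i) = odd-system⇒≈0 (eliminate system) i
  odd-system⇒≈0 {g = g} system zero = x*y≈0⇒y≈0 (odd⇒ι≉0 (pivot-odd system)) (begin
    ι (pivot system) * g zero  ≈⟨ pivot-row system ⟩
    two R * rest system zero   ≈⟨ *-congˡ (lincomb-zeroʳ (OddSystem.W system zero ∘ suc) (odd-system⇒≈0 (eliminate system))) ⟩
    two R * 0#                 ≈⟨ zeroʳ _ ⟩
    0#                         ∎)

  -- The determinant trick: 1/2 is not integral over ℤ.
  half-stable-span⇒≈0 : (g : Fin n → Carrier) (u : Carrier) →
                        (∀ i → Span g (u * g i)) → 1# ≈ two R * u → ∀ i → g i ≈ 0#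
  half-stable-span⇒≈0 g u u*g∈ 1≈2u = odd-system⇒≈0 (record
    { d     = λ _ → ℤ.1ℤ
    ; W     = λ i → proj₁ (u*g∈ i)
    ; d-odd = λ _ → odd-1
    ; row   = λ i → begin
        1# * g i                            ≈⟨ *-congʳ 1≈2u ⟩
        two R * u * g i                     ≈⟨ *-assoc _ _ _ ⟩
        two R * (u * g i)                   ≈⟨ *-congˡ (proj₂ (u*g∈ i)) ⟩
        two R * lincomb (proj₁ (u*g∈ i)) g  ∎
    })

  module Descent {s} {S : Carrier → Set s} (S-subring : IsSubring S)
                 (half∉S : ∀ {u} → S u → ¬ 1# ≈ two R * u) where
    open IsSubring S-subring
    open import Algebra.Properties.Semiring.Exp semiring using (_^_; ^-homo-*)
    open import Algebra.Properties.CommutativeSemiring.Exp commutativeSemiring using (^-distrib-*)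

    2S : Carrier → Set (c ⊔ ℓ ⊔ s)
    2S y = ∃ λ u → S u × y ≈ two R * u

    1∉2S : ¬ 2S 1#
    1∉2S (u , u∈S , 1≈2u) = half∉S u∈S 1≈2u

    2S-resp-≈ : x ≈ y → 2S x → 2S y
    2S-resp-≈ x≈y (u , u∈S , x≈2u) = u , u∈S , trans (sym x≈y) x≈2u

    2S-+ : 2S x → 2S y → 2S (x + y)
    2S-+ (u , u∈S , x≈2u) (v , v∈S , y≈2v) =
      u + v , +-closed u∈S v∈S , trans (+-cong x≈2u y≈2v) (sym (distribˡ (two R) u v))

    2S-*ʳ : 2S x → S y → 2S (x * y)
    2S-*ʳ {y = y} (u , u∈S , x≈2u) y∈S =
      u * y , *-closed u∈S y∈S , trans (*-congʳ x≈2u) (*-assoc (two R) u y)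

    2S-two* : S x → 2S (two R * x)
    2S-two* x∈S = _ , x∈S , refl

    geometric : Carrier → ℕ → Carrier
    geometric x zero    = 0#
    geometric x (suc r) = 1# + x * geometric x r

    geometric-telescopes : ∀ x r → (1# - x) * geometric x r ≈ 1# - x ^ r
    geometric-telescopes x zero    = trans (zeroʳ _) (sym (-‿inverseʳ 1#))
    geometric-telescopes x (suc r) = begin
      (1# - x) * (1# + x * geometric x r)
        ≈⟨ solve 2 (λ x G → (con (+ 1) :- x) :* (con (+ 1) :+ x :* G)
                          := (con (+ 1) :- x) :+ x :* ((con (+ 1) :- x) :* G)) refl x (geometric x r) ⟩
      (1# - x) + x * ((1# - x) * geometric x r)  ≈⟨ +-congˡ (*-congˡ (geometric-telescopes x r)) ⟩
      (1# - x) + x * (1# - x ^ r)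
        ≈⟨ solve 2 (λ x xʳ → (con (+ 1) :- x) :+ x :* (con (+ 1) :- xʳ) := con (+ 1) :- x :* xʳ) refl x (x ^ r) ⟩
      1# - x * x ^ r                             ∎

    geometric-∈ : S x → ∀ r → S (geometric x r)
    geometric-∈ x∈S zero    = ι∈ (+ 0)
    geometric-∈ x∈S (suc r) = +-closed 1∈ (*-closed x∈S (geometric-∈ x∈S r))

    geometric≡count : S x → 2S (1# - x) → ∀ r → 2S (ι (+ r) - geometric x r)
    geometric≡count x∈S 1-x∈2S zero    = 0# , ι∈ (+ 0) , solve 0 (con (+ 0) :- con (+ 0) := con (+ 2) :* con (+ 0)) refl
    geometric≡count {x} x∈S 1-x∈2S (suc r) = 2S-resp-≈ (begin
      (ι (+ r) - G) + (1# - x) * G        ≈⟨ solve 3 (λ n x G → (n :- G) :+ (con (+ 1) :- x) :* G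
                                                              := (con (+ 1) :+ n) :- (con (+ 1) :+ x :* G))
                                                  refl (ι (+ r)) x G ⟩
      (1# + ι (+ r)) - (1# + x * G)       ≈⟨ +-congʳ (ι-suc r) ⟨
      ι (+ suc r) - geometric x (suc r)   ∎)
      (2S-+ (geometric≡count x∈S 1-x∈2S r) (2S-*ʳ 1-x∈2S (geometric-∈ x∈S r)))
      where
      G : Carrier
      G = geometric x r

    odd-root≡1[mod2]⇒≈1 : ∀ q → S x → x ^ suc (q ℕ.+ q) ≈ 1# → 2S (1# - x) → ¬ x ≈ 1# → ⊥
    odd-root≡1[mod2]⇒≈1 {x} q x∈S xⁿ≈1 1-x∈2S x≉1 =
      1∉2S (2S-resp-≈ count-2q≈1 (2S-+ (geometric≡count x∈S 1-x∈2S 2q+1) (2S-two* (ι∈ (ℤ.- + q)))))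
      where
      2q+1 : ℕ
      2q+1 = suc (q ℕ.+ q)

      Gₙ≈0 : geometric x 2q+1 ≈ 0#
      Gₙ≈0 = x*y≈0⇒y≈0 (x≉1 ∘ sym ∘ x∙y⁻¹≈ε⇒x≈y 1# x) (begin
        (1# - x) * geometric x 2q+1  ≈⟨ geometric-telescopes x 2q+1 ⟩
        1# - x ^ 2q+1                ≈⟨ +-congˡ (-‿cong xⁿ≈1) ⟩
        1# - 1#                   ≈⟨ -‿inverseʳ 1# ⟩
        0#                        ∎)

      count-2q≈1 : (ι (+ 2q+1) - geometric x 2q+1) + two R * ι (ℤ.- + q) ≈ 1#
      count-2q≈1 = begin
        (ι (+ 2q+1) - geometric x 2q+1) + two R * ι (ℤ.- + q)
          ≈⟨ +-cong (+-cong (trans (ι-suc (q ℕ.+ q)) (+-congˡ (ι-+ (+ q) (+ q)))) (-‿cong Gₙ≈0))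
                    (*-congˡ (ι-neg (+ q))) ⟩
        (1# + (ι (+ q) + ι (+ q)) - 0#) + two R * - ι (+ q)
          ≈⟨ solve 1 (λ q → (con (+ 1) :+ (q :+ q) :- con (+ 0)) :+ con (+ 2) :* (:- q) := con (+ 1))
                   refl (ι (+ q)) ⟩
        1#  ∎

    ≡1[mod2]⇒x*x≉-1 : S x → 2S (1# - x) → ¬ x * x ≈ - 1#
    ≡1[mod2]⇒x*x≉-1 {x} x∈S (w , w∈S , 1-x≈2w) x*x≈-1 =
      half∉S (*-closed (*-closed w∈S w∈S) x∈S) (sym (begin
        two R * (w * w * x)
          ≈⟨ solve 2 (λ w x → con (+ 2) :* (w :* w :* x)
                          := x :* (con (+ 2) :* w :* w :+ x) :- x :* x) refl w x ⟩
        x * (two R * w * w + x) - x * x  ≈⟨ +-cong (*-congˡ 2ww+x≈0) (-‿cong x*x≈-1) ⟩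
        x * 0# - - 1#
          ≈⟨ solve 1 (λ x → x :* con (+ 0) :- (:- con (+ 1)) := con (+ 1)) refl x ⟩
        1#                               ∎))
      where
      2ww+x≈0 : two R * w * w + x ≈ 0#
      2ww+x≈0 = x*y≈0⇒y≈0 two≉0 (begin
        two R * (two R * w * w + x)
          ≈⟨ solve 2 (λ w x → con (+ 2) :* (con (+ 2) :* w :* w :+ x)
                          := (con (+ 2) :* w) :* (con (+ 2) :* w) :+ con (+ 2) :* x) refl w x ⟩
        (two R * w) * (two R * w) + two R * x  ≈⟨ +-congʳ (*-cong 1-x≈2w 1-x≈2w) ⟨
        (1# - x) * (1# - x) + two R * x
          ≈⟨ solve 1 (λ x → (con (+ 1) :- x) :* (con (+ 1) :- x) :+ con (+ 2) :* x
                          := con (+ 1) :+ x :* x) refl x ⟩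
        1# + x * x                              ≈⟨ +-congˡ x*x≈-1 ⟩
        1# - 1#                                 ≈⟨ -‿inverseʳ 1# ⟩
        0#                                      ∎)

    root-of-unity≡1[mod2]⇒±1 : ∀ n → 0 < n → S x → x ^ n ≈ 1# → 2S (1# - x) →
                               ¬ x ≈ 1# → ¬ x ≈ - 1# → ⊥
    root-of-unity≡1[mod2]⇒±1 {x} n = <-rec Claim descend n {x}
      where
      Claim : ℕ → Set (c ⊔ ℓ ⊔ s)
      Claim n = ∀ {x} → 0 < n → S x → x ^ n ≈ 1# → 2S (1# - x) → ¬ x ≈ 1# → ¬ x ≈ - 1# → ⊥

      descend : ∀ n → (∀ {m} → m < n → Claim m) → Claim n
      descend n rec {x} 0<n x∈S xⁿ≈1 1-x∈2S x≉1 x≉-1 with parityView n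
      ... | odd q        = odd-root≡1[mod2]⇒≈1 q x∈S xⁿ≈1 1-x∈2S x≉1
      ... | even zero    with () ← 0<n
      ... | even (suc q) = rec (ℕ.m<m+n (suc q) (s≤s z≤n)) (s≤s z≤n) (*-closed x∈S x∈S)
        (trans (^-distrib-* x x (suc q)) (trans (sym (^-homo-* x (suc q) (suc q))) xⁿ≈1))
        (2S-resp-≈ (solve 1 (λ x → (con (+ 1) :- x) :* (con (+ 1) :+ x) := con (+ 1) :- x :* x) refl x)
                   (2S-*ʳ 1-x∈2S (+-closed 1∈ x∈S)))
        (x≉-1 ∘ x*x≈1⇒x≈-1 x≉1)
        (≡1[mod2]⇒x*x≉-1 x∈S 1-x∈2S)

module PrimitiveRoots {c ℓ : Level} (R : CommutativeRing c ℓ) (isField : IsField R) (charZero : CharZero R)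
                      (m : ℕ) (ζ : CommutativeRing.Carrier R) (ζ-primitive : IsPrimitiveRoot R ζ (suc m)) where
  open CommutativeRing R hiding (zero)
  open IntegerImage R
  open Subrings R
  open LinearCombinations R
  open CharZeroField R isField charZero
  open import Algebra.Properties.Ring ring using (-1*x≈-x)
  open import Algebra.Properties.Semiring.Exp semiring using (_^_; ^-homo-*; ^-assocʳ; ^-congˡ)
  open import Data.Nat.DivMod using (_%_; _/_; m≡m%n+[m/n]*n; m%n<n)
  open import Relation.Binary.Reasoning.Setoid setoid

  private variable
    i j : ℕ
    x y : Carrier

  K : ℕ
  K = suc m

  G : Carrier → Set ℓ
  G = Powers R ζ K

  1^n≈1 : ∀ n → 1# ^ n ≈ 1#
  1^n≈1 zero    = refl
  1^n≈1 (suc n) = trans (*-identityˡ _) (1^n≈1 n)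

  ζ^-root : ∀ i → (ζ ^ i) ^ K ≈ 1#
  ζ^-root i = begin
    (ζ ^ i) ^ K     ≈⟨ ^-assocʳ ζ i K ⟩
    ζ ^ (i ℕ.* K)   ≡⟨ ≡.cong (ζ ^_) (ℕ.*-comm i K) ⟩
    ζ ^ (K ℕ.* i)   ≈⟨ ^-assocʳ ζ K i ⟨
    (ζ ^ K) ^ i     ≈⟨ ^-congˡ i (proj₁ ζ-primitive) ⟩
    1# ^ i          ≈⟨ 1^n≈1 i ⟩
    1#              ∎

  ζ^-mod : ∀ n → ζ ^ (n % K) ≈ ζ ^ n
  ζ^-mod n = sym (begin
    ζ ^ n                              ≡⟨ ≡.cong (ζ ^_) (m≡m%n+[m/n]*n n K) ⟩
    ζ ^ (n % K ℕ.+ (n / K) ℕ.* K)      ≈⟨ ^-homo-* ζ (n % K) _ ⟩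
    ζ ^ (n % K) * ζ ^ ((n / K) ℕ.* K)  ≈⟨ *-congˡ (^-assocʳ ζ (n / K) K) ⟨
    ζ ^ (n % K) * (ζ ^ (n / K)) ^ K    ≈⟨ *-congˡ (ζ^-root (n / K)) ⟩
    ζ ^ (n % K) * 1#                   ≈⟨ *-identityʳ _ ⟩
    ζ ^ (n % K)                        ∎)

  G-resp-≈ : x ≈ y → G x → G y
  G-resp-≈ x≈y (i , i<K , x≈ζⁱ) = i , i<K , trans (sym x≈y) x≈ζⁱ

  ζ^∈G : ∀ n → G (ζ ^ n)
  ζ^∈G n = n % K , m%n<n n K , sym (ζ^-mod n)

  G-* : G x → G y → G (x * y)
  G-* (i , _ , x≈ζⁱ) (j , _ , y≈ζʲ) =
    G-resp-≈ (trans (^-homo-* ζ i j) (sym (*-cong x≈ζⁱ y≈ζʲ))) (ζ^∈G (i ℕ.+ j))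

  G-root : G x → x ^ K ≈ 1#
  G-root (i , _ , x≈ζⁱ) = trans (^-congˡ K x≈ζⁱ) (ζ^-root i)

  G-inverse : G x → ∃ λ x⁻¹ → G x⁻¹ × x * x⁻¹ ≈ 1#
  G-inverse {x} (i , i<K , x≈ζⁱ) = ζ ^ (K ∸ i) , ζ^∈G (K ∸ i) , (begin
    x * ζ ^ (K ∸ i)        ≈⟨ *-congʳ x≈ζⁱ ⟩
    ζ ^ i * ζ ^ (K ∸ i)    ≈⟨ ^-homo-* ζ i (K ∸ i) ⟨
    ζ ^ (i ℕ.+ (K ∸ i))    ≡⟨ ≡.cong (ζ ^_) (ℕ.m+[n∸m]≡n (ℕ.<⇒≤ i<K)) ⟩
    ζ ^ K                  ≈⟨ proj₁ ζ-primitive ⟩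
    1#                     ∎)

  G⇒≉0 : G x → ¬ x ≈ 0#
  G⇒≉0 x∈G with G-inverse x∈G
  ... | _ , _ , x*x⁻¹≈1 = x*y≈1⇒x≉0 x*x⁻¹≈1

  ζ^-injective-< : i < j → j < K → ¬ ζ ^ i ≈ ζ ^ j
  ζ^-injective-< {i} {j} i<j j<K ζⁱ≈ζʲ =
    proj₂ ζ-primitive (j ∸ i) (ℕ.m<n⇒0<n∸m i<j) (ℕ.≤-<-trans (ℕ.m∸n≤m j i) j<K)
      (sym (*-cancelˡ (G⇒≉0 (ζ^∈G i)) (begin
        ζ ^ i * 1#               ≈⟨ *-identityʳ _ ⟩
        ζ ^ i                    ≈⟨ ζⁱ≈ζʲ ⟩
        ζ ^ j                    ≡⟨ ≡.cong (ζ ^_) (ℕ.m+[n∸m]≡n (ℕ.<⇒≤ i<j)) ⟨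
        ζ ^ (i ℕ.+ (j ∸ i))      ≈⟨ ^-homo-* ζ i (j ∸ i) ⟩
        ζ ^ i * ζ ^ (j ∸ i)      ∎)))

  ζ^-injective : i < K → j < K → ζ ^ i ≈ ζ ^ j → i ≡ j
  ζ^-injective {i} {j} i<K j<K ζⁱ≈ζʲ with ℕ.<-cmp i j
  ... | tri< i<j _ _ = ⊥-elim (ζ^-injective-< i<j j<K ζⁱ≈ζʲ)
  ... | tri≈ _ i≡j _ = i≡j
  ... | tri> _ _ j<i = ⊥-elim (ζ^-injective-< j<i i<K (sym ζⁱ≈ζʲ))

  G-≈? : G x → G y → Dec (x ≈ y)
  G-≈? (i , i<K , x≈ζⁱ) (j , j<K , y≈ζʲ) = Dec.map′
    (λ i≡j → trans x≈ζⁱ (trans (reflexive (≡.cong (ζ ^_) i≡j)) (sym y≈ζʲ)))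
    (λ x≈y → ζ^-injective i<K j<K (trans (sym x≈ζⁱ) (trans x≈y y≈ζʲ)))
    (i ℕ.≟ j)

  -1∈G : 2 ∣ K → G (- 1#)
  -1∈G (divides (suc h) K≡h*2) = suc h , h<K , sym (x*x≈1⇒x≈-1 ζʰ≉1 ζʰ*ζʰ≈1)
    where
    h<K : suc h < K
    h<K = ≡.subst (suc h <_) (≡.sym K≡h*2) (ℕ.m<m*n (suc h) 2 (s≤s (s≤s z≤n)))

    ζʰ≉1 : ¬ ζ ^ suc h ≈ 1#
    ζʰ≉1 = proj₂ ζ-primitive (suc h) (s≤s z≤n) h<K

    ζʰ*ζʰ≈1 : ζ ^ suc h * ζ ^ suc h ≈ 1#
    ζʰ*ζʰ≈1 = begin
      ζ ^ suc h * ζ ^ suc h  ≈⟨ *-congˡ (*-identityʳ _) ⟨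
      (ζ ^ suc h) ^ 2        ≈⟨ ^-assocʳ ζ (suc h) 2 ⟩
      ζ ^ (suc h ℕ.* 2)      ≡⟨ ≡.cong (ζ ^_) K≡h*2 ⟨
      ζ ^ K                  ≈⟨ proj₁ ζ-primitive ⟩
      1#                     ∎

  G-neg : 2 ∣ K → G x → G (- x)
  G-neg 2∣K x∈G = G-resp-≈ (-1*x≈-x _) (G-* (-1∈G 2∣K) x∈G)

  ζ-powers : Fin K → Carrier
  ζ-powers j = ζ ^ toℕ j

  ℤ[ζ] : Carrier → Set ℓ
  ℤ[ζ] = Span ζ-powers

  G⊆ℤ[ζ] : G x → ℤ[ζ] x
  G⊆ℤ[ζ] (i , i<K , x≈ζⁱ) =
    Span-resp-≈ {g = ζ-powers} (trans (reflexive (≡.cong (ζ ^_) (toℕ-fromℕ< i<K))) (sym x≈ζⁱ))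
                (Span-generator ζ-powers (fromℕ< i<K))

  ℤ[ζ]-isSubring : IsSubring ℤ[ζ]
  ℤ[ζ]-isSubring = Span-isSubring
    (λ i j → G⊆ℤ[ζ] (G-* (ζ^∈G (toℕ i)) (ζ^∈G (toℕ j))))
    (Span-generator ζ-powers zero)

  open IsSubring ℤ[ζ]-isSubring

  half∉ℤ[ζ] : ∀ {u} → ℤ[ζ] u → ¬ 1# ≈ two R * u
  half∉ℤ[ζ] {u} u∈ℤ[ζ] 1≈2u = proj₁ isField
    (half-stable-span⇒≈0 ζ-powers u (λ i → *-closed u∈ℤ[ζ] (Span-generator ζ-powers i)) 1≈2u zero)

  open Descent ℤ[ζ]-isSubring half∉ℤ[ζ]

  G-≡[mod2]⇒≈± : ∀ {a b e} → G a → G b → ℤ[ζ] e → a - b ≈ two R * e → ¬ a ≈ b → ¬ a ≈ - b → ⊥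
  G-≡[mod2]⇒≈± {a} {b} {e} a∈G b∈G e∈ℤ[ζ] a-b≈2e a≉b a≉-b with G-inverse b∈G
  ... | b⁻¹ , b⁻¹∈G , b*b⁻¹≈1 =
    root-of-unity≡1[mod2]⇒±1 K (s≤s z≤n) (G⊆ℤ[ζ] x∈G) (G-root x∈G) 1-x∈2S
      (λ x≈1 → a≉b (trans a≈x*b (trans (*-congʳ x≈1) (*-identityˡ b))))
      (λ x≈-1 → a≉-b (trans a≈x*b (trans (*-congʳ x≈-1) (-1*x≈-x b))))
    where
    x∈G : G (a * b⁻¹)
    x∈G = G-* a∈G b⁻¹∈G

    a≈x*b : a ≈ a * b⁻¹ * b
    a≈x*b = begin
      a               ≈⟨ *-identityʳ a ⟨
      a * 1#          ≈⟨ *-congˡ b*b⁻¹≈1 ⟨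
      a * (b * b⁻¹)   ≈⟨ solve 3 (λ a b b⁻¹ → a :* (b :* b⁻¹) := a :* b⁻¹ :* b) refl a b b⁻¹ ⟩
      a * b⁻¹ * b     ∎

    1-x∈2S : 2S (1# - a * b⁻¹)
    1-x∈2S = - e * b⁻¹ , *-closed (-‿closed e∈ℤ[ζ]) (G⊆ℤ[ζ] b⁻¹∈G) , (begin
      1# - a * b⁻¹           ≈⟨ +-congʳ b*b⁻¹≈1 ⟨
      b * b⁻¹ - a * b⁻¹      ≈⟨ solve 3 (λ a b b⁻¹ → b :* b⁻¹ :- a :* b⁻¹ := (:- (a :- b)) :* b⁻¹) refl a b b⁻¹ ⟩
      (- (a - b)) * b⁻¹      ≈⟨ *-congʳ (-‿cong a-b≈2e) ⟩
      (- (two R * e)) * b⁻¹  ≈⟨ solve 2 (λ e b⁻¹ → (:- (con (+ 2) :* e)) :* b⁻¹ := con (+ 2) :* (:- e :* b⁻¹)) refl e b⁻¹ ⟩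
      two R * (- e * b⁻¹)    ∎)

  G-2-maximal : 2 ∣ K → Is2Maximal R G
  G-2-maximal 2∣K = -1∈G 2∣K , maximal
    where
    maximal : ∀ a b c′ d → G a → G b → G c′ → G d → a - b ≈ two R * (c′ - d) → a ≈ b ⊎ a ≈ - b
    maximal a b c′ d a∈G b∈G c′∈G d∈G a-b≈2[c′-d] with G-≈? a∈G b∈G | G-≈? a∈G (G-neg 2∣K b∈G)
    ... | yes a≈b | _        = inj₁ a≈b
    ... | no _    | yes a≈-b = inj₂ a≈-b
    ... | no a≉b  | no a≉-b  = ⊥-elim (G-≡[mod2]⇒≈± a∈G b∈G
                                 (+-closed (G⊆ℤ[ζ] c′∈G) (-‿closed (G⊆ℤ[ζ] d∈G))) a-b≈2[c′-d] a≉b a≉-b)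

lemma5p1 : {c ℓ : Level} (R : CommutativeRing c ℓ) → IsField R → CharZero R →
    (k : ℕ) → 0 < k → 2 ∣ k → (ζ : CommutativeRing.Carrier R) → IsPrimitiveRoot R ζ k →
    Is2Maximal R (Powers R ζ k)
lemma5p1 R isField charZero (suc m) _ 2∣k ζ ζ-primitive =
  PrimitiveRoots.G-2-maximal R isField charZero m ζ ζ-primitive 2∣k
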